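{- Let $G=(V,E)$ be a finite, connected, undirected, unweighted graph with shortest-path distance $d$, and let $\mathbf{L}\subseteq V$ be a set of landmarks. Then the dual landmark heuristic $\pi_t^{DL}$ does not dominate the ALT heuristic $\pi_t^{L}$ over the same set of landmarks $\mathbf{L}$; that is, it is not the case in general that $\pi_t^{DL}(v)\ge\pi_t^{L}(v)$ for all vertices $v$ and targets $t$.
   Context: The ALT heuristic is $\pi_t^{L}(v)=\max_{l\in\mathbf{L}}|d(v,l)-d(t,l)|$. The dual landmark heuristic uses landmarks $l_1,l_2\in\mathbf{L}$ (under distributed embedding, $l_1$ is the landmark to which $v$ is assigned and $l_2$ the landmark to which $t$ is assigned, each vertex being assigned to exactly one landmark of $\mathbf{L}$) and is $\pi_t^{DL}(v)=\max_i\pi_t^{DL}(v,i)$ over the defined terms among $\pi_t^{DL}(v,1)=|d(v,l_1)-d(l_1,l_2)|-d(l_2,t)$, $\pi_t^{DL}(v,2)=|d(v,l_1)-d(l_2,t)|-d(l_1,l_2)$, $\pi_t^{DL}(v,3)=|d(l_1,l_2)-d(l_2,t)|-d(v,l_1)$, $\pi_t^{DL}(v,4)=|d(v,l_1)-d(l_1,t)|$, $\pi_t^{DL}(v,5)=|d(v,l_2)-d(l_2,t)|$ (terms 4 and 5 used only when $l_1=l_2$), $\pi_t^{DL}(v,6)=\dfrac{|d(v,l_1)-d(l_1,l_2)|\cdot|d(l_1,l_2)-d(l_2,t)|-d(v,l_1)\cdot d(l_2,t)}{d(l_1,l_2)}$ (only when $l_1\neq l_2$). A heuristic $h_1$ dominates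 a heuristic $h_2$ if $h_1(v)\ge h_2(v)$ for all vertices $v$ (and targets $t$). -}

module Defs where

open import Level using (Level; 0ℓ) renaming (suc to lsuc)
open import Data.Nat as ℕ using (ℕ; zero; suc; _+_; _*_; _≤_; ∣_-_∣)
open import Data.Fin using (Fin)
open import Data.Integer as ℤ using (ℤ; +_; _⊖_)
open import Data.Rational using (ℚ; 0ℚ; _/_; _⊔_)
open import Data.List using (List; []; _∷_; map; foldr)
open import Data.List.Membership.Propositional using (_∈_)
open import Data.Product using (Σ; _×_)
open import Relation.Binary.PropositionalEquality using (_≡_)
open import Relation.Nullary using (¬_)
open import Data.Fin using (_≟_)
open import Relation.Nullary using (yes; no)

record Graph (n : ℕ) : Set₁ where
  field
    Adj       : Fin n → Fin n → Set
    symmetric : ∀ {u v} → Adj u v → Adj v u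
    irreflexive : ∀ {u} → ¬ Adj u u
open Graph public

data Walk {n : ℕ} (G : Graph n) : Fin n → Fin n → ℕ → Set where
  here  : ∀ {u} → Walk G u u 0
  step  : ∀ {u v w k} → Adj G u v → Walk G v w k → Walk G u w (suc k)

Connected : ∀ {n} → Graph n → Set
Connected {n} G = ∀ (u v : Fin n) → Σ ℕ (λ k → Walk G u v k)

IsShortestPathDistance : ∀ {n} → Graph n → (Fin n → Fin n → ℕ) → Set
IsShortestPathDistance {n} G d =
  ∀ (u v : Fin n) → Walk G u v (d u v) × (∀ {k} → Walk G u v k → d u v ≤ k)

maxℕ : List ℕ → ℕ
maxℕ = foldr ℕ._⊔_ 0

maxℚ : ℚ → List ℚ → ℚ
maxℚ q qs = foldr _⊔_ q qs

altH : ∀ {n} → (Fin n → Fin n → ℕ) → List (Fin n) → Fin n → Fin n → ℕ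
altH d L t v = maxℕ (map (λ l → ∣ d v l - d t l ∣) L)

-- Integer z divided by natural k (as a rational); only used with k ≠ 0
-- (k = d(l₁,l₂) with l₁ ≠ l₂ in a connected graph); default 0 otherwise.
divℕ : ℤ → ℕ → ℚ
divℕ z zero    = 0ℚ
divℕ z (suc k) = z / suc k

ℕtoℚ : ℕ → ℚ
ℕtoℚ k = + k / 1

ℤtoℚ : ℤ → ℚ
ℤtoℚ z = z / 1

-- Dual landmark heuristic with l₁ = a v, l₂ = a t (a = distributed embedding
-- assignment of each vertex to one landmark).
dlH : ∀ {n} → (Fin n → Fin n → ℕ) → (Fin n → Fin n) → Fin n → Fin n → ℚ
dlH d a t v with a v | a t | a v ≟ a t
... | l₁ | l₂ | yes _ = maxℚ t1 (t2 ∷ t3 ∷ t4 ∷ t5 ∷ [])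
  where
    t1 = ℤtoℚ (∣ d v l₁ - d l₁ l₂ ∣ ⊖ d l₂ t)
    t2 = ℤtoℚ (∣ d v l₁ - d l₂ t ∣ ⊖ d l₁ l₂)
    t3 = ℤtoℚ (∣ d l₁ l₂ - d l₂ t ∣ ⊖ d v l₁)
    t4 = ℕtoℚ ∣ d v l₁ - d l₁ t ∣
    t5 = ℕtoℚ ∣ d v l₂ - d l₂ t ∣
... | l₁ | l₂ | no _ = maxℚ t1 (t2 ∷ t3 ∷ t6 ∷ [])
  where
    t1 = ℤtoℚ (∣ d v l₁ - d l₁ l₂ ∣ ⊖ d l₂ t)
    t2 = ℤtoℚ (∣ d v l₁ - d l₂ t ∣ ⊖ d l₁ l₂)
    t3 = ℤtoℚ (∣ d l₁ l₂ - d l₂ t ∣ ⊖ d v l₁)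
    t6 = divℕ ((∣ d v l₁ - d l₁ l₂ ∣ * ∣ d l₁ l₂ - d l₂ t ∣) ⊖ (d v l₁ * d l₂ t))
              (d l₁ l₂)

DLDominatesALT : ∀ {n} → (Fin n → Fin n → ℕ) → List (Fin n) → (Fin n → Fin n) → Set
DLDominatesALT {n} d L a =
  ∀ (t v : Fin n) → ℕtoℚ (altH d L t v) Data.Rational.≤ dlH d a t v

module Submission where

-- Take the path left – centre – right with landmarks {centre, left}, every vertex assigned to
-- centre. Then l₁ = l₂ = centre, so all dual landmark terms only involve distances to the centre,
-- which are equal (1) for both leaves: π^DL_right(left) = 0. The ALT term of the landmark left,
-- however, is |d(left, left) − d(right, left)| = 2.

open import Defs
open import Data.Nat using (ℕ; _≤_; z≤n; s≤s)
open import Data.Fin using (Fin; zero; suc)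
open import Data.List using (List; []; _∷_)
open import Data.List.Membership.Propositional using (_∈_)
open import Data.List.Relation.Unary.Any using (here)
open import Data.Product using (Σ; _×_; _,_; proj₁)
open import Data.Unit using (⊤; tt)
open import Data.Empty using (⊥)
open import Relation.Nullary using (¬_)
open import Relation.Nullary.Decidable using (toWitness)
open import Relation.Binary.PropositionalEquality using (refl)
import Data.Rational as ℚ
open import Data.Rational.Properties using (<-irrefl; <-≤-trans)

shortestPathDistance⇒connected : ∀ {n} {G : Graph n} {d : Fin n → Fin n → ℕ} →
                                 IsShortestPathDistance G d → Connected G
shortestPathDistance⇒connected {d = d} isDist u v = d u v , proj₁ (isDist u v)

¬dominates : ∀ {n} {d : Fin n → Fin n → ℕ} {L : List (Fin n)} {a : Fin n → Fin n} (t v : Fin n) →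
             dlH d a t v ℚ.< ℕtoℚ (altH d L t v) → ¬ DLDominatesALT d L a
¬dominates t v dl<alt dominates = <-irrefl refl (<-≤-trans dl<alt (dominates t v))

pattern centre = zero
pattern left   = suc zero
pattern right  = suc (suc zero)

StarAdj : Fin 3 → Fin 3 → Set
StarAdj centre left   = ⊤
StarAdj centre right  = ⊤
StarAdj left   centre = ⊤
StarAdj right  centre = ⊤
StarAdj _      _      = ⊥

StarAdj-sym : ∀ {u v} → StarAdj u v → StarAdj v u
StarAdj-sym {centre} {left}   _ = tt
StarAdj-sym {centre} {right}  _ = tt
StarAdj-sym {left}   {centre} _ = tt
StarAdj-sym {right}  {centre} _ = tt

StarAdj-irrefl : ∀ {u} → ¬ StarAdj u u
StarAdj-irrefl {centre} ()
StarAdj-irrefl {left}   ()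
StarAdj-irrefl {right}  ()

star : Graph 3
star = record
  { Adj         = StarAdj
  ; symmetric   = λ {u} {v} → StarAdj-sym {u} {v}
  ; irreflexive = λ {u} → StarAdj-irrefl {u}
  }

starDist : Fin 3 → Fin 3 → ℕ
starDist centre centre = 0
starDist left   left   = 0
starDist right  right  = 0
starDist centre _      = 1
starDist _      centre = 1
starDist _      _      = 2

starDist-walk : ∀ u v → Walk star u v (starDist u v)
starDist-walk centre centre = here
starDist-walk centre left   = step tt here
starDist-walk centre right  = step tt here
starDist-walk left   centre = step tt here
starDist-walk left   left   = here
starDist-walk left   right  = step {v = centre} tt (step tt here)
starDist-walk right  centre = step tt here
starDist-walk right  left   = step {v = centre} tt (step tt here)
starDist-walk right  right  = here

-- The omitted cases are absurd: a walk between the leaves must step to the centre first.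
starDist-minimal : ∀ u v {k} → Walk star u v k → starDist u v ≤ k
starDist-minimal centre centre _                                 = z≤n
starDist-minimal left   left   _                                 = z≤n
starDist-minimal right  right  _                                 = z≤n
starDist-minimal centre left   (step _ _)                        = s≤s z≤n
starDist-minimal centre right  (step _ _)                        = s≤s z≤n
starDist-minimal left   centre (step _ _)                        = s≤s z≤n
starDist-minimal right  centre (step _ _)                        = s≤s z≤n
starDist-minimal left   right  (step {v = centre} _ (step _ _))  = s≤s (s≤s z≤n)
starDist-minimal right  left   (step {v = centre} _ (step _ _))  = s≤s (s≤s z≤n)

starDist-isShortestPathDistance : IsShortestPathDistance star starDist
starDist-isShortestPathDistance u v = starDist-walk u v , starDist-minimal u v

landmarks : List (Fin 3)
landmarks = centre ∷ left ∷ []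

toCentre : Fin 3 → Fin 3
toCentre _ = centre

dual<alt : dlH starDist toCentre right left ℚ.< ℕtoℚ (altH starDist landmarks right left)
dual<alt = toWitness {a? = _ ℚ.<? _} tt

theorem3 : Σ ℕ λ n → Σ (Graph n) λ G → Σ (Fin n → Fin n → ℕ) λ d → Σ (List (Fin n)) λ L → Σ (Fin n → Fin n) λ a →
    Connected G × IsShortestPathDistance G d × (∀ v → a v ∈ L) × ¬ DLDominatesALT d L a
theorem3 =
  3 , star , starDist , landmarks , toCentre ,
  shortestPathDistance⇒connected starDist-isShortestPathDistance ,
  starDist-isShortestPathDistance ,
  (λ _ → here refl) ,
  ¬dominates {d = starDist} {landmarks} {toCentre} right left dual<alt
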